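{- Let $\omega = \tfrac12 + \tfrac{\sqrt{ -11}}{2}$ and $\mathcal{E}_{ -11} = \{ n \in \mathbb{Z}[\omega] : |n|^2 \le 5\} \setminus \{2,-2\}$. For every $n \in \mathbb{Z}[\omega] \setminus \mathcal{E}_{ -11}$ there exist nonzero $a,b,c \in \mathbb{Z}[\omega]$ with $\frac{4}{n} = \frac1a + \frac1b + \frac1c$.
   Context: $\mathbb{Z}[\omega]$ is the ring of integers of $\mathbb{Q}(\sqrt{ -11})$; for $n = x + y\omega$ with $x,y\in\mathbb{Z}$, $|n|^2 = x^2 + xy + 3y^2$. -}

module Defs where

open import Data.Integer using (ℤ; +_; -_; _+_; _*_; _-_; _≤_)
open import Data.Product using (_×_)
open import Relation.Binary.PropositionalEquality using (_≡_; _≢_)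

-- Elements x + y ω of ℤ[ω], ω = 1/2 + √-11/2, so ω² = ω - 3.
record ℤω : Set where
  constructor _+_ω
  field
    re : ℤ
    im : ℤ
open ℤω public

infixl 6 _⊕_
infixl 7 _⊗_

_⊕_ : ℤω → ℤω → ℤω
(a + b ω) ⊕ (c + d ω) = (a + c) + (b + d) ω

-- (a + bω)(c + dω) = ac + (ad + bc)ω + bd ω² = (ac - 3bd) + (ad + bc + bd)ω
_⊗_ : ℤω → ℤω → ℤω
(a + b ω) ⊗ (c + d ω) = (a * c - + 3 * (b * d)) + (a * d + b * c + b * d) ω

ι : ℤ → ℤω
ι k = k + (+ 0) ω

normSq : ℤω → ℤ
normSq (x + y ω) = x * x + x * y + + 3 * (y * y)

E₋₁₁ : ℤω → Set
E₋₁₁ n = (normSq n ≤ + 5) × (n ≢ ι (+ 2)) × (n ≢ ι (- (+ 2)))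

{-# OPTIONS --safe #-}
-- Split n by its residue modulo 4.  If n = 2m then 4/n = 1/m + 1/(2m) + 1/(2m); if n = 2m + 1 then
-- n² − 1 = 4m(m + 1) gives 4/n = 1/(m + 1) + 1/m − 1/(nm(m + 1)).  In the eight classes whose
-- ω-coordinate is odd there is a representative ρ of norm 4 + σ with σ = ±1 (namely ±ω, ±(1 − ω),
-- ±(1 + ω), ±(2 − ω)), so s = −ρ̄ satisfies σ(ρs + 4) = −1.  For n = 4k + ρ and t = sk − 1 this
-- gives 4/n = s/t + 1/(σnt), and s/t = 1/k + 1/(kt).  The norm is multiplicative and positive
-- definite, so the denominators vanish only for the excluded n; t ≠ 0 because s is not a unit.
module Submission where

open import Defs
open import Data.Integer using (+_; -_; _+_; _*_; _-_; -[1+_]; ∣_∣; _≤_; +≤+)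
import Data.Integer.Properties as ℤ
open import Data.Integer.DivMod using (_/ℕ_; _%ℕ_; a≡a%ℕn+[a/ℕn]*n; n%ℕd<d)
import Data.Integer.Tactic.RingSolver as ℤ-Solver
open import Data.Nat using (suc; z≤n; s≤s; _<_)
import Data.Nat as ℕ
import Data.Nat.Properties as ℕ
open import Data.List using (_∷_; [])
open import Data.Maybe using (just; nothing)
open import Data.Product using (∃; _×_; _,_; proj₁; proj₂)
open import Data.Sum using ([_,_]′)
open import Function using (id)
open import Level using (0ℓ)
open import Relation.Nullary using (¬_)
open import Relation.Binary.PropositionalEquality
open import Algebra.Bundles using (CommutativeRing)
import Tactic.RingSolver as Solver
open import Tactic.RingSolver.Core.AlmostCommutativeRing using (AlmostCommutativeRing; fromCommutativeRing)

0ω 1ω -1ω : ℤω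
0ω = ι (+ 0)
1ω = ι (+ 1)
-1ω = ι (- (+ 1))

⊖_ : ℤω → ℤω
⊖ (a + b ω) = (- a) + (- b) ω

⊕-assoc : ∀ u v w → (u ⊕ v) ⊕ w ≡ u ⊕ (v ⊕ w)
⊕-assoc (a + b ω) (c + d ω) (e + f ω) = cong₂ _+_ω (ℤ.+-assoc a c e) (ℤ.+-assoc b d f)

⊕-comm : ∀ u v → u ⊕ v ≡ v ⊕ u
⊕-comm (a + b ω) (c + d ω) = cong₂ _+_ω (ℤ.+-comm a c) (ℤ.+-comm b d)

⊕-identityˡ : ∀ u → 0ω ⊕ u ≡ u
⊕-identityˡ (a + b ω) = cong₂ _+_ω (ℤ.+-identityˡ a) (ℤ.+-identityˡ b)

⊕-identityʳ : ∀ u → u ⊕ 0ω ≡ u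
⊕-identityʳ (a + b ω) = cong₂ _+_ω (ℤ.+-identityʳ a) (ℤ.+-identityʳ b)

⊖-inverseˡ : ∀ u → (⊖ u) ⊕ u ≡ 0ω
⊖-inverseˡ (a + b ω) = cong₂ _+_ω (ℤ.+-inverseˡ a) (ℤ.+-inverseˡ b)

⊖-inverseʳ : ∀ u → u ⊕ (⊖ u) ≡ 0ω
⊖-inverseʳ (a + b ω) = cong₂ _+_ω (ℤ.+-inverseʳ a) (ℤ.+-inverseʳ b)

⊗-comm : ∀ u v → u ⊗ v ≡ v ⊗ u
⊗-comm (a + b ω) (c + d ω) =
  cong₂ _+_ω (ℤ-Solver.solve (a ∷ b ∷ c ∷ d ∷ [])) (ℤ-Solver.solve (a ∷ b ∷ c ∷ d ∷ []))

⊗-assoc : ∀ u v w → (u ⊗ v) ⊗ w ≡ u ⊗ (v ⊗ w)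
⊗-assoc (a + b ω) (c + d ω) (e + f ω) = cong₂ _+_ω real imag
  where
  real : (a * c - + 3 * (b * d)) * e - + 3 * ((a * d + b * c + b * d) * f)
     ≡ a * (c * e - + 3 * (d * f)) - + 3 * (b * (c * f + d * e + d * f))
  real = ℤ-Solver.solve (a ∷ b ∷ c ∷ d ∷ e ∷ f ∷ [])
  imag : (a * c - + 3 * (b * d)) * f + (a * d + b * c + b * d) * e + (a * d + b * c + b * d) * f
     ≡ a * (c * f + d * e + d * f) + b * (c * e - + 3 * (d * f)) + b * (c * f + d * e + d * f)
  imag = ℤ-Solver.solve (a ∷ b ∷ c ∷ d ∷ e ∷ f ∷ [])

⊗-identityˡ : ∀ u → 1ω ⊗ u ≡ u
⊗-identityˡ (a + b ω) = cong₂ _+_ω (ℤ-Solver.solve (a ∷ b ∷ [])) (ℤ-Solver.solve (a ∷ b ∷ []))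

⊗-identityʳ : ∀ u → u ⊗ 1ω ≡ u
⊗-identityʳ u = trans (⊗-comm u 1ω) (⊗-identityˡ u)

⊗-distribˡ-⊕ : ∀ u v w → u ⊗ (v ⊕ w) ≡ u ⊗ v ⊕ u ⊗ w
⊗-distribˡ-⊕ (a + b ω) (c + d ω) (e + f ω) = cong₂ _+_ω real imag
  where
  real : a * (c + e) - + 3 * (b * (d + f)) ≡ (a * c - + 3 * (b * d)) + (a * e - + 3 * (b * f))
  real = ℤ-Solver.solve (a ∷ b ∷ c ∷ d ∷ e ∷ f ∷ [])
  imag : a * (d + f) + b * (c + e) + b * (d + f) ≡ (a * d + b * c + b * d) + (a * f + b * e + b * f)
  imag = ℤ-Solver.solve (a ∷ b ∷ c ∷ d ∷ e ∷ f ∷ [])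

⊗-distribʳ-⊕ : ∀ u v w → (v ⊕ w) ⊗ u ≡ v ⊗ u ⊕ w ⊗ u
⊗-distribʳ-⊕ u v w = begin
  (v ⊕ w) ⊗ u     ≡⟨ ⊗-comm (v ⊕ w) u ⟩
  u ⊗ (v ⊕ w)     ≡⟨ ⊗-distribˡ-⊕ u v w ⟩
  u ⊗ v ⊕ u ⊗ w   ≡⟨ cong₂ _⊕_ (⊗-comm u v) (⊗-comm u w) ⟩
  v ⊗ u ⊕ w ⊗ u   ∎
  where open ≡-Reasoning

ℤω-commutativeRing : CommutativeRing 0ℓ 0ℓ
ℤω-commutativeRing = record
  { _+_ = _⊕_ ; _*_ = _⊗_ ; -_ = ⊖_ ; 0# = 0ω ; 1# = 1ω
  ; isCommutativeRing = record
    { isRing = record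
      { +-isAbelianGroup = record
        { isGroup = record
          { isMonoid = record
            { isSemigroup = record
              { isMagma = record { isEquivalence = isEquivalence ; ∙-cong = cong₂ _⊕_ }
              ; assoc = ⊕-assoc }
            ; identity = ⊕-identityˡ , ⊕-identityʳ }
          ; inverse = ⊖-inverseˡ , ⊖-inverseʳ
          ; ⁻¹-cong = cong ⊖_ }
        ; comm = ⊕-comm }
      ; *-cong = cong₂ _⊗_
      ; *-assoc = ⊗-assoc
      ; *-identity = ⊗-identityˡ , ⊗-identityʳ
      ; distrib = ⊗-distribˡ-⊕ , ⊗-distribʳ-⊕ }
    ; *-comm = ⊗-comm }
  }

ℤω-ring : AlmostCommutativeRing 0ℓ 0ℓ
ℤω-ring = fromCommutativeRing ℤω-commutativeRing λ
  { ((+ 0) + (+ 0) ω) → just refl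
  ; _ → nothing }

⊗-zeroʳ : ∀ u → u ⊗ 0ω ≡ 0ω
⊗-zeroʳ = CommutativeRing.zeroʳ ℤω-commutativeRing

normSq-⊗ : ∀ u v → normSq (u ⊗ v) ≡ normSq u * normSq v
normSq-⊗ (a + b ω) (c + d ω) = expand
  where
  expand : (a * c - + 3 * (b * d)) * (a * c - + 3 * (b * d))
         + (a * c - + 3 * (b * d)) * (a * d + b * c + b * d)
         + + 3 * ((a * d + b * c + b * d) * (a * d + b * c + b * d))
         ≡ (a * a + a * b + + 3 * (b * b)) * (c * c + c * d + + 3 * (d * d))
  expand = ℤ-Solver.solve (a ∷ b ∷ c ∷ d ∷ [])

i*i≡+∣i∣*∣i∣ : ∀ i → i * i ≡ + (∣ i ∣ ℕ.* ∣ i ∣)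
i*i≡+∣i∣*∣i∣ (+ n)    = ℤ.+◃n≡+n (n ℕ.* n)
i*i≡+∣i∣*∣i∣ -[1+ n ] = ℤ.+◃n≡+n (suc n ℕ.* suc n)

i*i+11*j*j≡0⇒i≡0×j≡0 : ∀ i j → i * i + + 11 * (j * j) ≡ + 0 → i ≡ + 0 × j ≡ + 0
i*i+11*j*j≡0⇒i≡0×j≡0 i j eq =
  ℤ.∣i∣≡0⇒i≡0 (m*m≡0⇒m≡0 (ℕ.m+n≡0⇒m≡0 (∣ i ∣ ℕ.* ∣ i ∣) inℕ)) ,
  ℤ.∣i∣≡0⇒i≡0 (m*m≡0⇒m≡0 ([ (λ ()) , id ]′ (ℕ.m*n≡0⇒m≡0∨n≡0 11 (ℕ.m+n≡0⇒n≡0 (∣ i ∣ ℕ.* ∣ i ∣) inℕ))))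
  where
  open ≡-Reasoning
  m*m≡0⇒m≡0 : ∀ {m} → m ℕ.* m ≡ 0 → m ≡ 0
  m*m≡0⇒m≡0 {m} mm≡0 = [ id , id ]′ (ℕ.m*n≡0⇒m≡0∨n≡0 m mm≡0)
  inℕ : ∣ i ∣ ℕ.* ∣ i ∣ ℕ.+ 11 ℕ.* (∣ j ∣ ℕ.* ∣ j ∣) ≡ 0
  inℕ = ℤ.+-injective (begin
    + (∣ i ∣ ℕ.* ∣ i ∣ ℕ.+ 11 ℕ.* (∣ j ∣ ℕ.* ∣ j ∣))  ≡⟨ ℤ.pos-+ (∣ i ∣ ℕ.* ∣ i ∣) (11 ℕ.* (∣ j ∣ ℕ.* ∣ j ∣)) ⟩
    + (∣ i ∣ ℕ.* ∣ i ∣) + + (11 ℕ.* (∣ j ∣ ℕ.* ∣ j ∣)) ≡⟨ cong (λ v → + (∣ i ∣ ℕ.* ∣ i ∣) + v) (ℤ.pos-* 11 (∣ j ∣ ℕ.* ∣ j ∣)) ⟩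
    + (∣ i ∣ ℕ.* ∣ i ∣) + + 11 * + (∣ j ∣ ℕ.* ∣ j ∣)   ≡⟨ cong₂ (λ u v → u + + 11 * v) (i*i≡+∣i∣*∣i∣ i) (i*i≡+∣i∣*∣i∣ j) ⟨
    i * i + + 11 * (j * j)                             ≡⟨ eq ⟩
    + 0                                                ∎)

normSq≡0⇒≡0ω : ∀ z → normSq z ≡ + 0 → z ≡ 0ω
normSq≡0⇒≡0ω (x + y ω) N≡0 with i*i+11*j*j≡0⇒i≡0×j≡0 (+ 2 * x + y) y (trans completing-the-square (cong (+ 4 *_) N≡0))
  where
  completing-the-square : (+ 2 * x + y) * (+ 2 * x + y) + + 11 * (y * y) ≡ + 4 * (x * x + x * y + + 3 * (y * y))
  completing-the-square = ℤ-Solver.solve (x ∷ y ∷ [])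
... | 2x≡0 , refl = cong (_+ + 0 ω) ([ (λ ()) , id ]′ (ℤ.i*j≡0⇒i≡0∨j≡0 (+ 2) (trans (sym (ℤ.+-identityʳ (+ 2 * x))) 2x≡0)))

⊗-≢0ω : ∀ {u v} → u ≢ 0ω → v ≢ 0ω → u ⊗ v ≢ 0ω
⊗-≢0ω {u} {v} u≢0 v≢0 uv≡0 =
  [ (λ Nu≡0 → u≢0 (normSq≡0⇒≡0ω u Nu≡0)) , (λ Nv≡0 → v≢0 (normSq≡0⇒≡0ω v Nv≡0)) ]′
  (ℤ.i*j≡0⇒i≡0∨j≡0 (normSq u) (trans (sym (normSq-⊗ u v)) (cong normSq uv≡0)))

⊗≡1ω⇒∣normSq∣≡1 : ∀ u v → u ⊗ v ≡ 1ω → ∣ normSq u ∣ ≡ 1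
⊗≡1ω⇒∣normSq∣≡1 u v uv≡1 = ℕ.m*n≡1⇒m≡1 ∣ normSq u ∣ ∣ normSq v ∣ (begin
  ∣ normSq u ∣ ℕ.* ∣ normSq v ∣ ≡⟨ ℤ.abs-* (normSq u) (normSq v) ⟨
  ∣ normSq u * normSq v ∣       ≡⟨ cong ∣_∣ (normSq-⊗ u v) ⟨
  ∣ normSq (u ⊗ v) ∣            ≡⟨ cong (λ w → ∣ normSq w ∣) uv≡1 ⟩
  1                             ∎)
  where open ≡-Reasoning

ErdősStraus : ℤω → Set
ErdősStraus n = ∃ λ a → ∃ λ b → ∃ λ c →
  a ≢ ι (+ 0) × b ≢ ι (+ 0) × c ≢ ι (+ 0) ×
  ι (+ 4) ⊗ a ⊗ b ⊗ c ≡ n ⊗ (b ⊗ c ⊕ a ⊗ c ⊕ a ⊗ b)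

erdősStraus-2m : ∀ m → ι (+ 2) ⊗ m ≢ 0ω → ErdősStraus (ι (+ 2) ⊗ m)
erdősStraus-2m m n≢0 =
  m , ι (+ 2) ⊗ m , ι (+ 2) ⊗ m , m≢0 , n≢0 , n≢0 , Solver.solve (m ∷ []) ℤω-ring
  where
  m≢0 : m ≢ 0ω
  m≢0 m≡0 = n≢0 (cong (ι (+ 2) ⊗_) m≡0)

erdősStraus-2m+1 : ∀ m → ι (+ 2) ⊗ m ⊕ 1ω ≢ 0ω → m ≢ 0ω → m ⊕ 1ω ≢ 0ω →
                   ErdősStraus (ι (+ 2) ⊗ m ⊕ 1ω)
erdősStraus-2m+1 m n≢0 m≢0 m+1≢0 =
  m ⊕ 1ω , m , -1ω ⊗ (ι (+ 2) ⊗ m ⊕ 1ω) ⊗ m ⊗ (m ⊕ 1ω) ,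
  m+1≢0 , m≢0 , ⊗-≢0ω (⊗-≢0ω (⊗-≢0ω {u = -1ω} (λ ()) n≢0) m≢0) m+1≢0 ,
  Solver.solve (m ∷ []) ℤω-ring

egyptian-split : ∀ n s σ k t → ι (+ 4) ⊗ σ ⊗ t ≡ σ ⊗ s ⊗ n ⊕ 1ω → s ⊗ k ≡ t ⊕ 1ω →
  ι (+ 4) ⊗ k ⊗ (k ⊗ t) ⊗ (σ ⊗ n ⊗ t) ≡ n ⊗ ((k ⊗ t) ⊗ (σ ⊗ n ⊗ t) ⊕ k ⊗ (σ ⊗ n ⊗ t) ⊕ k ⊗ (k ⊗ t))
egyptian-split n s σ k t 4σt≡σsn+1 sk≡t+1 = begin
  ι (+ 4) ⊗ k ⊗ (k ⊗ t) ⊗ (σ ⊗ n ⊗ t)          ≡⟨ Solver.solve (k ∷ t ∷ n ∷ σ ∷ []) ℤω-ring ⟩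
  k ⊗ k ⊗ n ⊗ t ⊗ (ι (+ 4) ⊗ σ ⊗ t)            ≡⟨ cong (k ⊗ k ⊗ n ⊗ t ⊗_) 4σt≡σsn+1 ⟩
  k ⊗ k ⊗ n ⊗ t ⊗ (σ ⊗ s ⊗ n ⊕ 1ω)             ≡⟨ Solver.solve (k ∷ t ∷ n ∷ σ ∷ s ∷ []) ℤω-ring ⟩
  k ⊗ n ⊗ (σ ⊗ n ⊗ t ⊗ (s ⊗ k) ⊕ k ⊗ t)        ≡⟨ cong (λ u → k ⊗ n ⊗ (σ ⊗ n ⊗ t ⊗ u ⊕ k ⊗ t)) sk≡t+1 ⟩
  k ⊗ n ⊗ (σ ⊗ n ⊗ t ⊗ (t ⊕ 1ω) ⊕ k ⊗ t)       ≡⟨ Solver.solve (k ∷ t ∷ n ∷ σ ∷ []) ℤω-ring ⟩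
  n ⊗ ((k ⊗ t) ⊗ (σ ⊗ n ⊗ t) ⊕ k ⊗ (σ ⊗ n ⊗ t) ⊕ k ⊗ (k ⊗ t)) ∎
  where open ≡-Reasoning

erdősStraus-4k+ρ : ∀ ρ s σ → σ ⊗ (ρ ⊗ s ⊕ ι (+ 4)) ≡ -1ω → (∀ v → s ⊗ v ≢ 1ω) →
                   ∀ k → ι (+ 4) ⊗ k ⊕ ρ ≢ 0ω → k ≢ 0ω → ErdősStraus (ι (+ 4) ⊗ k ⊕ ρ)
erdősStraus-4k+ρ ρ s σ σ[ρs+4]≡-1 s-nonunit k n≢0 k≢0 =
  k , k ⊗ (s ⊗ k ⊕ -1ω) , σ ⊗ (ι (+ 4) ⊗ k ⊕ ρ) ⊗ (s ⊗ k ⊕ -1ω) ,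
  k≢0 , ⊗-≢0ω k≢0 t≢0 , ⊗-≢0ω (⊗-≢0ω σ≢0 n≢0) t≢0 ,
  egyptian-split (ι (+ 4) ⊗ k ⊕ ρ) s σ k (s ⊗ k ⊕ -1ω) 4σt≡σsn+1 sk≡t+1
  where
  open ≡-Reasoning
  σ≢0 : σ ≢ 0ω
  σ≢0 σ≡0 with trans (cong (_⊗ (ρ ⊗ s ⊕ ι (+ 4))) (sym σ≡0)) σ[ρs+4]≡-1
  ... | ()
  sk≡t+1 : s ⊗ k ≡ (s ⊗ k ⊕ -1ω) ⊕ 1ω
  sk≡t+1 = Solver.solve (s ∷ k ∷ []) ℤω-ring
  t≢0 : s ⊗ k ⊕ -1ω ≢ 0ω
  t≢0 t≡0 = s-nonunit k (trans sk≡t+1 (cong (_⊕ 1ω) t≡0))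
  4σt≡σsn+1 : ι (+ 4) ⊗ σ ⊗ (s ⊗ k ⊕ -1ω) ≡ σ ⊗ s ⊗ (ι (+ 4) ⊗ k ⊕ ρ) ⊕ 1ω
  4σt≡σsn+1 = sym (begin
    σ ⊗ s ⊗ (ι (+ 4) ⊗ k ⊕ ρ) ⊕ 1ω                                ≡⟨ Solver.solve (σ ∷ s ∷ k ∷ ρ ∷ []) ℤω-ring ⟩
    ι (+ 4) ⊗ σ ⊗ (s ⊗ k ⊕ -1ω) ⊕ (σ ⊗ (ρ ⊗ s ⊕ ι (+ 4)) ⊕ 1ω)    ≡⟨ cong (λ u → ι (+ 4) ⊗ σ ⊗ (s ⊗ k ⊕ -1ω) ⊕ (u ⊕ 1ω)) σ[ρs+4]≡-1 ⟩
    ι (+ 4) ⊗ σ ⊗ (s ⊗ k ⊕ -1ω) ⊕ 0ω                              ≡⟨ ⊕-identityʳ _ ⟩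
    ι (+ 4) ⊗ σ ⊗ (s ⊗ k ⊕ -1ω)                                   ∎)

conj : ℤω → ℤω
conj (x + y ω) = (x + y) + (- y) ω

⊗-⊖conj : ∀ z → z ⊗ (⊖ conj z) ≡ ι (- normSq z)
⊗-⊖conj (x + y ω) = cong₂ _+_ω real imag
  where
  real : x * (- (x + y)) - + 3 * (y * (- (- y))) ≡ - (x * x + x * y + + 3 * (y * y))
  real = ℤ-Solver.solve (x ∷ y ∷ [])
  imag : x * (- (- y)) + y * (- (x + y)) + y * (- (- y)) ≡ + 0
  imag = ℤ-Solver.solve (x ∷ y ∷ [])

normSq-⊖conj : ∀ z → normSq (⊖ conj z) ≡ normSq z
normSq-⊖conj (x + y ω) = expand
  where
  expand : (- (x + y)) * (- (x + y)) + (- (x + y)) * (- (- y)) + + 3 * ((- (- y)) * (- (- y)))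
         ≡ x * x + x * y + + 3 * (y * y)
  expand = ℤ-Solver.solve (x ∷ y ∷ [])

data Norm4±1 (ρ : ℤω) : Set where
  normSq≡3 : normSq ρ ≡ + 3 → Norm4±1 ρ
  normSq≡5 : normSq ρ ≡ + 5 → Norm4±1 ρ

Norm4±1⇒normSq≤5 : ∀ {ρ} → Norm4±1 ρ → normSq ρ ≤ + 5
Norm4±1⇒normSq≤5 (normSq≡3 N≡3) rewrite N≡3 = +≤+ (ℕ.m≤m+n 3 2)
Norm4±1⇒normSq≤5 (normSq≡5 N≡5) rewrite N≡5 = ℤ.≤-refl

Norm4±1⇒normSq≢4 : ∀ {ρ} → Norm4±1 ρ → normSq ρ ≢ + 4
Norm4±1⇒normSq≢4 (normSq≡3 N≡3) N≡4 with trans (sym N≡3) N≡4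
... | ()
Norm4±1⇒normSq≢4 (normSq≡5 N≡5) N≡4 with trans (sym N≡5) N≡4
... | ()

Norm4±1⇒E₋₁₁ : ∀ {ρ} → Norm4±1 ρ → E₋₁₁ ρ
Norm4±1⇒E₋₁₁ N =
  Norm4±1⇒normSq≤5 N ,
  (λ ρ≡2 → Norm4±1⇒normSq≢4 N (cong normSq ρ≡2)) ,
  (λ ρ≡-2 → Norm4±1⇒normSq≢4 N (cong normSq ρ≡-2))

Norm4±1⇒σ[ρs+4]≡-1 : ∀ {ρ} → Norm4±1 ρ → ∃ λ σ → σ ⊗ (ρ ⊗ (⊖ conj ρ) ⊕ ι (+ 4)) ≡ -1ω
Norm4±1⇒σ[ρs+4]≡-1 {ρ} (normSq≡3 N≡3) =
  -1ω , cong (λ u → -1ω ⊗ (u ⊕ ι (+ 4))) (trans (⊗-⊖conj ρ) (cong (λ N → ι (- N)) N≡3))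
Norm4±1⇒σ[ρs+4]≡-1 {ρ} (normSq≡5 N≡5) =
  1ω , cong (λ u → 1ω ⊗ (u ⊕ ι (+ 4))) (trans (⊗-⊖conj ρ) (cong (λ N → ι (- N)) N≡5))

Norm4±1⇒∣normSq∣≢1 : ∀ {ρ} → Norm4±1 ρ → ∣ normSq ρ ∣ ≢ 1
Norm4±1⇒∣normSq∣≢1 (normSq≡3 N≡3) rewrite N≡3 = λ ()
Norm4±1⇒∣normSq∣≢1 (normSq≡5 N≡5) rewrite N≡5 = λ ()

Norm4±1⇒⊖conj-nonunit : ∀ {ρ} → Norm4±1 ρ → ∀ v → (⊖ conj ρ) ⊗ v ≢ 1ω
Norm4±1⇒⊖conj-nonunit {ρ} N v sv≡1 =
  Norm4±1⇒∣normSq∣≢1 N (trans (cong ∣_∣ (sym (normSq-⊖conj ρ))) (⊗≡1ω⇒∣normSq∣≡1 (⊖ conj ρ) v sv≡1))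

data Shape : ℤω → Set where
  ≡0mod2 : ∀ m → Shape (ι (+ 2) ⊗ m)
  ≡1mod2 : ∀ m → Shape (ι (+ 2) ⊗ m ⊕ 1ω)
  ≡ρmod4 : ∀ ρ → Norm4±1 ρ → ∀ k → Shape (ι (+ 4) ⊗ k ⊕ ρ)

shape-4q+2h : ∀ q h → Shape (ι (+ 4) ⊗ q ⊕ ι (+ 2) ⊗ h)
shape-4q+2h q h = subst Shape regroup (≡0mod2 (ι (+ 2) ⊗ q ⊕ h))
  where
  regroup : ι (+ 2) ⊗ (ι (+ 2) ⊗ q ⊕ h) ≡ ι (+ 4) ⊗ q ⊕ ι (+ 2) ⊗ h
  regroup = Solver.solve (q ∷ h ∷ []) ℤω-ring

shape-4q+2h+1 : ∀ q h → Shape (ι (+ 4) ⊗ q ⊕ (ι (+ 2) ⊗ h ⊕ 1ω))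
shape-4q+2h+1 q h = subst Shape regroup (≡1mod2 (ι (+ 2) ⊗ q ⊕ h))
  where
  regroup : ι (+ 2) ⊗ (ι (+ 2) ⊗ q ⊕ h) ⊕ 1ω ≡ ι (+ 4) ⊗ q ⊕ (ι (+ 2) ⊗ h ⊕ 1ω)
  regroup = Solver.solve (q ∷ h ∷ []) ℤω-ring

shape-4q+ρ+4d : ∀ ρ → Norm4±1 ρ → ∀ q d → Shape (ι (+ 4) ⊗ q ⊕ (ρ ⊕ ι (+ 4) ⊗ d))
shape-4q+ρ+4d ρ N q d = subst Shape regroup (≡ρmod4 ρ N (q ⊕ d))
  where
  regroup : ι (+ 4) ⊗ (q ⊕ d) ⊕ ρ ≡ ι (+ 4) ⊗ q ⊕ (ρ ⊕ ι (+ 4) ⊗ d)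
  regroup = Solver.solve (ρ ∷ q ∷ d ∷ []) ℤω-ring

residue-shape : ∀ q i j → i < 4 → j < 4 → Shape (ι (+ 4) ⊗ q ⊕ (+ i) + (+ j) ω)
residue-shape q 0 0 _ _ = shape-4q+2h q 0ω
residue-shape q 2 0 _ _ = shape-4q+2h q 1ω
residue-shape q 0 2 _ _ = shape-4q+2h q ((+ 0) + (+ 1) ω)
residue-shape q 2 2 _ _ = shape-4q+2h q ((+ 1) + (+ 1) ω)
residue-shape q 1 0 _ _ = shape-4q+2h+1 q 0ω
residue-shape q 3 0 _ _ = shape-4q+2h+1 q 1ω
residue-shape q 1 2 _ _ = shape-4q+2h+1 q ((+ 0) + (+ 1) ω)
residue-shape q 3 2 _ _ = shape-4q+2h+1 q ((+ 1) + (+ 1) ω)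
residue-shape q 0 1 _ _ = shape-4q+ρ+4d ((+ 0) + (+ 1) ω) (normSq≡3 refl) q 0ω
residue-shape q 1 1 _ _ = shape-4q+ρ+4d ((+ 1) + (+ 1) ω) (normSq≡5 refl) q 0ω
residue-shape q 2 1 _ _ = shape-4q+ρ+4d ((- (+ 2)) + (+ 1) ω) (normSq≡5 refl) q 1ω
residue-shape q 3 1 _ _ = shape-4q+ρ+4d ((- (+ 1)) + (+ 1) ω) (normSq≡3 refl) q 1ω
residue-shape q 0 3 _ _ = shape-4q+ρ+4d ((+ 0) + (- (+ 1)) ω) (normSq≡3 refl) q ((+ 0) + (+ 1) ω)
residue-shape q 1 3 _ _ = shape-4q+ρ+4d ((+ 1) + (- (+ 1)) ω) (normSq≡3 refl) q ((+ 0) + (+ 1) ω)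
residue-shape q 2 3 _ _ = shape-4q+ρ+4d ((+ 2) + (- (+ 1)) ω) (normSq≡5 refl) q ((+ 0) + (+ 1) ω)
residue-shape q 3 3 _ _ = shape-4q+ρ+4d ((- (+ 1)) + (- (+ 1)) ω) (normSq≡5 refl) q ((+ 1) + (+ 1) ω)
residue-shape q (suc (suc (suc (suc _)))) _ (s≤s (s≤s (s≤s (s≤s ())))) _
residue-shape q _ (suc (suc (suc (suc _)))) _ (s≤s (s≤s (s≤s (s≤s ()))))

divMod4 : ∀ x y → ι (+ 4) ⊗ (x /ℕ 4) + (y /ℕ 4) ω ⊕ (+ (x %ℕ 4)) + (+ (y %ℕ 4)) ω ≡ x + y ω
divMod4 x y = cong₂ _+_ω
  (trans (real (+ (x %ℕ 4)) (x /ℕ 4) (y /ℕ 4)) (sym (a≡a%ℕn+[a/ℕn]*n x 4)))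
  (trans (imag (+ (y %ℕ 4)) (y /ℕ 4) (x /ℕ 4)) (sym (a≡a%ℕn+[a/ℕn]*n y 4)))
  where
  real : ∀ r q q′ → + 4 * q - + 3 * (+ 0 * q′) + r ≡ r + q * + 4
  real = ℤ-Solver.solve-∀
  imag : ∀ r q q′ → + 4 * q + + 0 * q′ + + 0 * q + r ≡ r + q * + 4
  imag = ℤ-Solver.solve-∀

0∈E₋₁₁ : E₋₁₁ 0ω
0∈E₋₁₁ = +≤+ z≤n , (λ ()) , (λ ())

1∈E₋₁₁ : E₋₁₁ 1ω
1∈E₋₁₁ = +≤+ (s≤s z≤n) , (λ ()) , (λ ())

-1∈E₋₁₁ : E₋₁₁ -1ω
-1∈E₋₁₁ = +≤+ (s≤s z≤n) , (λ ()) , (λ ())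

shape : ∀ n → Shape n
shape (x + y ω) =
  subst Shape (divMod4 x y) (residue-shape ((x /ℕ 4) + (y /ℕ 4) ω) (x %ℕ 4) (y %ℕ 4) (n%ℕd<d x 4) (n%ℕd<d y 4))

∉E₋₁₁⇒≢ : ∀ {x c} (f : ℤω → ℤω) → ¬ E₋₁₁ (f x) → E₋₁₁ (f c) → x ≢ c
∉E₋₁₁⇒≢ f fx∉E fc∈E refl = fx∉E fc∈E

shape⇒erdősStraus : ∀ {n} → Shape n → ¬ E₋₁₁ n → ErdősStraus n
shape⇒erdősStraus (≡0mod2 m) n∉E = erdősStraus-2m m (∉E₋₁₁⇒≢ id n∉E 0∈E₋₁₁)
shape⇒erdősStraus (≡1mod2 m) n∉E =
  erdősStraus-2m+1 m (∉E₋₁₁⇒≢ id n∉E 0∈E₋₁₁) (∉E₋₁₁⇒≢ 2[_]+1 n∉E 1∈E₋₁₁) m+1≢0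
  where
  2[_]+1 : ℤω → ℤω
  2[ m ]+1 = ι (+ 2) ⊗ m ⊕ 1ω
  m≡[m+1]-1 : m ≡ (m ⊕ 1ω) ⊕ -1ω
  m≡[m+1]-1 = Solver.solve (m ∷ []) ℤω-ring
  m+1≢0 : m ⊕ 1ω ≢ 0ω
  m+1≢0 m+1≡0 = ∉E₋₁₁⇒≢ 2[_]+1 n∉E -1∈E₋₁₁ (trans m≡[m+1]-1 (cong (_⊕ -1ω) m+1≡0))
shape⇒erdősStraus (≡ρmod4 ρ N k) n∉E =
  erdősStraus-4k+ρ ρ (⊖ conj ρ) (proj₁ (Norm4±1⇒σ[ρs+4]≡-1 N)) (proj₂ (Norm4±1⇒σ[ρs+4]≡-1 N))
    (Norm4±1⇒⊖conj-nonunit N) k (∉E₋₁₁⇒≢ id n∉E 0∈E₋₁₁) (∉E₋₁₁⇒≢ (λ k → ι (+ 4) ⊗ k ⊕ ρ) n∉E ρ∈E)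
  where
  ρ∈E : E₋₁₁ (ι (+ 4) ⊗ 0ω ⊕ ρ)
  ρ∈E = subst E₋₁₁ (sym (⊕-identityˡ ρ)) (Norm4±1⇒E₋₁₁ N)

theorem14 : (n : ℤω) → ¬ E₋₁₁ n →
    ∃ λ a → ∃ λ b → ∃ λ c →
      a ≢ ι (+ 0) × b ≢ ι (+ 0) × c ≢ ι (+ 0) ×
      ι (+ 4) ⊗ a ⊗ b ⊗ c ≡ n ⊗ (b ⊗ c ⊕ a ⊗ c ⊕ a ⊗ b)
theorem14 n = shape⇒erdősStraus (shape n)
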